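{- Let $G$ be a graph and $A\subseteq V(G)$ a nonempty vertex set with $\mathrm{mim}_G(A)\le 1$, with a fixed chain order $<_A$ of $A$. Let $(S_{1,A},S_{2,A})$ and $(S'_{1,A},S'_{2,A})$ be polar pairs of $A$ with $(S_{1,A},S_{2,A})\equiv^{p}_A(S'_{1,A},S'_{2,A})$, and let $(S_{1,\overline{A}},S_{2,\overline{A}})$ be any pair of disjoint subsets of $\overline{A}=V(G)\setminus A$. Then (1) $S_{1,A}\cup S_{1,\overline{A}}$ is a cluster set of $G$ if and only if $S'_{1,A}\cup S_{1,\overline{A}}$ is a cluster set of $G$; and (2) $S_{2,A}\cup S_{2,\overline{A}}$ is a co-cluster set of $G$ if and only if $S'_{2,A}\cup S_{2,\overline{A}}$ is a co-cluster set of $G$.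
   Context: $\mathrm{mim}_G(A)$ is the maximum size of an induced matching among the edges between $A$ and $V(G)\setminus A$. $S$ is a cluster set if every component of $G[S]$ is complete; a co-cluster set if $S$ is a cluster set of the complement $\overline{G}$. A chain order of $A$ is a strict total order $<_A$ on $A$ with $v<_A w\Rightarrow N_G(v)\setminus A\subseteq N_G(w)\setminus A$; $<_A^{\mathrm{rev}}$ is its reverse. For a graph $H\in\{G,\overline{G}\}$, an order $<$ on $A$ and $S\subseteq A$, index the vertex sets of the components of $H[S]$ as $C_1,\dots,C_p$ so that $\max_<(C_j)<\max_<(C_i)$ for $i<j$, with $C_i=\emptyset$ for $i>p$ and $\max,\min$ of $\emptyset$ equal to $\emptyset$; write $S\equiv_{H,<}S'$ if $\max_<(C_1)=\max_<(C'_1)$, $\min_<(C_1)=\min_<(C'_1)$, $\max_<(C_2)=\max_<(C'_2)$. Let $\equiv_A$ be $\equiv_{G,<_A}$ and $\equiv^{cc}_A$ be $\equiv_{\overline{G},<_A^{\mathrm{rev}}}$. A polar pair of $A$ is a pair $(S_1,S_2)$ of disjoint subsets of $A$ with $S_1$ a cluster set and $S_2$ a co-cluster set of $G$. For pairs of disjoint subsets of $A$, $(S_1,S_2)\equiv^p_A(S'_1,S'_2)$ means $S_1\equiv_A S'_1$ and $S_2\equiv^{cc}_A S'_2$. -}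

module Defs where

open import Data.Nat using (ℕ; _≤_)
open import Data.Bool using (Bool; true; false; not; _∧_)
open import Data.Fin using (Fin; _≟_)
open import Data.Fin.Subset using (Subset; _∈_; _∉_; _⊆_; ∁; _∪_; Nonempty)
open import Data.List using (List; length; lookup)
open import Data.Maybe using (Maybe; just; nothing)
open import Data.Product using (Σ; _×_; _,_; proj₁; proj₂)
open import Data.Sum using (_⊎_)
open import Function using (flip)
open import Function.Bundles using (_⇔_)
open import Relation.Nullary using (¬_; yes; no)
open import Relation.Nullary.Decidable using (⌊_⌋)
open import Relation.Binary.PropositionalEquality using (_≡_; _≢_; refl; sym; cong₂)

record Graph (n : ℕ) : Set where
  field
    adj        : Fin n → Fin n → Bool
    adj-sym    : ∀ u v → adj u v ≡ adj v u
    adj-irrefl : ∀ v → adj v v ≡ false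

open Graph public

Edge : ∀ {n} → Graph n → Fin n → Fin n → Set
Edge G u v = adj G u v ≡ true

private
  eqb : ∀ {n} (u v : Fin n) → Bool
  eqb u v = ⌊ u ≟ v ⌋

  eqb-sym : ∀ {n} (u v : Fin n) → eqb u v ≡ eqb v u
  eqb-sym u v with u ≟ v | v ≟ u
  ... | yes _ | yes _ = refl
  ... | no _ | no _ = refl
  ... | yes p | no q = Data.Empty.⊥-elim (q (sym p))
    where import Data.Empty
  ... | no p | yes q = Data.Empty.⊥-elim (p (sym q))
    where import Data.Empty

  eqb-refl : ∀ {n} (v : Fin n) → eqb v v ≡ true
  eqb-refl v with v ≟ v
  ... | yes _ = refl
  ... | no p = Data.Empty.⊥-elim (p refl)
    where import Data.Empty

  ∧-false : ∀ b → b ∧ false ≡ false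
  ∧-false true = refl
  ∧-false false = refl

complement : ∀ {n} → Graph n → Graph n
complement G = record
  { adj = λ u v → not (adj G u v) ∧ not (eqb u v)
  ; adj-sym = λ u v → cong₂ (λ a b → not a ∧ not b) (adj-sym G u v) (eqb-sym u v)
  ; adj-irrefl = λ v → Relation.Binary.PropositionalEquality.trans
      (cong₂ (λ a b → not a ∧ not b) refl (eqb-refl v)) (∧-false (not (adj G v v)))
  }

data Conn {n} (G : Graph n) (S : Subset n) : Fin n → Fin n → Set where
  here : ∀ {u} → u ∈ S → Conn G S u u
  step : ∀ {u v w} → Conn G S u v → Edge G v w → w ∈ S → Conn G S u w

ClusterSet : ∀ {n} → Graph n → Subset n → Set
ClusterSet G S = ∀ u v → Conn G S u v → u ≡ v ⊎ Edge G u v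

CoClusterSet : ∀ {n} → Graph n → Subset n → Set
CoClusterSet G S = ClusterSet (complement G) S

Disjoint : ∀ {n} → Subset n → Subset n → Set
Disjoint S T = ∀ x → x ∈ S → x ∉ T

-- Induced matchings of the bipartite graph of edges between A and V(G) \ A,
-- given as a list of pairs (a_i , b_i) with a_i ∈ A, b_i ∉ A.
InducedMatching : ∀ {n} → Graph n → Subset n → List (Fin n × Fin n) → Set
InducedMatching G A M =
  (∀ i → proj₁ (lookup M i) ∈ A × proj₂ (lookup M i) ∉ A
         × Edge G (proj₁ (lookup M i)) (proj₂ (lookup M i)))
  × (∀ i j → i ≢ j →
       proj₁ (lookup M i) ≢ proj₁ (lookup M j)
       × proj₂ (lookup M i) ≢ proj₂ (lookup M j)
       × ¬ Edge G (proj₁ (lookup M i)) (proj₂ (lookup M j)))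

MimAtMost : ∀ {n} → Graph n → Subset n → ℕ → Set
MimAtMost G A k = ∀ M → InducedMatching G A M → length M ≤ k

record ChainOrder {n} (G : Graph n) (A : Subset n) : Set₁ where
  field
    _<_     : Fin n → Fin n → Set
    <-irrefl : ∀ x → x ∈ A → ¬ (x < x)
    <-trans  : ∀ x y z → x ∈ A → y ∈ A → z ∈ A → x < y → y < z → x < z
    <-tri    : ∀ x y → x ∈ A → y ∈ A → (x < y) ⊎ (x ≡ y) ⊎ (y < x)
    chain    : ∀ v w → v ∈ A → w ∈ A → v < w →
               ∀ u → u ∉ A → Edge G v u → Edge G w u

-- IsMaxOf R P o : o is the R-maximum of the set P, with nothing for the empty set.
IsMaxOf : ∀ {n} → (Fin n → Fin n → Set) → (Fin n → Set) → Maybe (Fin n) → Set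
IsMaxOf R P nothing  = ∀ x → ¬ P x
IsMaxOf R P (just m) = P m × (∀ x → P x → x ≢ m → R x m)

-- First component C_1 of H[S]: the one containing the maximum of S.
Comp₁ : ∀ {n} → Graph n → (Fin n → Fin n → Set) → Subset n → Fin n → Set
Comp₁ H R S x = Σ _ λ m → IsMaxOf R (_∈ S) (just m) × Conn H S m x

-- Second component C_2 of H[S]: the one containing the maximum of S \ C_1.
Comp₂ : ∀ {n} → Graph n → (Fin n → Fin n → Set) → Subset n → Fin n → Set
Comp₂ H R S x =
  Σ _ λ m → IsMaxOf R (λ y → y ∈ S × ¬ Comp₁ H R S y) (just m) × Conn H S m x

-- S ≡_{H,<} S' : max(C_1), min(C_1), max(C_2) coincide (as optional values).
EquivH : ∀ {n} → Graph n → (Fin n → Fin n → Set) → Subset n → Subset n → Set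
EquivH H R S S' =
  (∀ o → IsMaxOf R (Comp₁ H R S) o ⇔ IsMaxOf R (Comp₁ H R S') o)
  × (∀ o → IsMaxOf (flip R) (Comp₁ H R S) o ⇔ IsMaxOf (flip R) (Comp₁ H R S') o)
  × (∀ o → IsMaxOf R (Comp₂ H R S) o ⇔ IsMaxOf R (Comp₂ H R S') o)

EquivA : ∀ {n} {G : Graph n} {A : Subset n} → ChainOrder G A → Subset n → Subset n → Set
EquivA {G = G} O = EquivH G (ChainOrder._<_ O)

EquivCC : ∀ {n} {G : Graph n} {A : Subset n} → ChainOrder G A → Subset n → Subset n → Set
EquivCC {G = G} O = EquivH (complement G) (flip (ChainOrder._<_ O))

PolarPair : ∀ {n} → Graph n → Subset n → Subset n → Subset n → Set
PolarPair G A S₁ S₂ = S₁ ⊆ A × S₂ ⊆ A × Disjoint S₁ S₂ × ClusterSet G S₁ × CoClusterSet G S₂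

EquivP : ∀ {n} {G : Graph n} {A : Subset n} → ChainOrder G A →
         Subset n → Subset n → Subset n → Subset n → Set
EquivP O S₁ S₂ S₁' S₂' = EquivA O S₁ S₁' × EquivCC O S₂ S₂'

-- Both parts are one statement about a graph H (G for part 1; for part 2 the complement of G, for
-- which the reversed chain order of A is again a chain order): if S, S' ⊆ A are cluster sets with the
-- same max C₁, min C₁ and max C₂, and T ⊆ V ∖ A, then S ∪ T is a cluster set only if S' ∪ T is.
-- Cluster sets are exactly the sets without an induced P₃. Let M₁ = max S = max S'; then C₁(S') is
-- the closed neighbourhood of M₁ in S'. The chain property moves neighbours of t ∈ T upwards, so
-- t ~ x ∈ S' gives t ~ M₁; if moreover x ∉ C₁(S') then t ~ max C₂(S), and M₁ - t - max C₂(S) is an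
-- induced P₃ in S ∪ T. Conversely t ~ M₁ forces t ~ min C₁(S) = min C₁(S'), hence t ~ all of C₁(S').
-- So each t ∈ T sees in S' either nothing or exactly C₁(S'), which contains M₁ ∈ S; this turns any
-- induced P₃ in S' ∪ T into one in S ∪ T.
module Submission where

open import Defs
open import Data.Nat using (ℕ)
open import Data.Bool using (true; false)
import Data.Bool as Bool
open import Data.Empty using (⊥-elim)
open import Data.Fin using (Fin; _≟_)
open import Data.Fin.Subset using (Subset; _⊆_; ∁; _∪_; Nonempty; _∈_; _∉_)
open import Data.Fin.Subset.Properties using (_∈?_; x∈∁p⇒x∉p; x∈p∪q⁻; x∈p∪q⁺)
open import Data.List using (List; []; _∷_; allFin)
open import Data.List.Relation.Unary.Any using (here; there)
open import Data.List.Membership.Propositional using () renaming (_∈_ to _∈ₗ_)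
open import Data.List.Membership.Propositional.Properties using (∈-allFin)
open import Data.Maybe using (just)
open import Data.Product using (∃; _×_; _,_; proj₁; proj₂)
open import Data.Sum using (_⊎_; inj₁; inj₂; map; map₁)
open import Function using (flip; _∘_)
open import Function.Bundles using (_⇔_; mk⇔; Equivalence)
open import Function.Construct.Symmetry using (⇔-sym)
open import Relation.Nullary using (¬_; Dec; yes; no)
open import Relation.Nullary.Decidable using (¬?; _×-dec_; _⊎-dec_)
open import Relation.Binary.PropositionalEquality using (_≡_; _≢_; refl; sym; trans; subst)

record StrictTotalOn {n} (A : Subset n) (_<_ : Fin n → Fin n → Set) : Set where
  field
    <-irrefl : ∀ x → x ∈ A → ¬ (x < x)
    <-trans  : ∀ x y z → x ∈ A → y ∈ A → z ∈ A → x < y → y < z → x < z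
    <-tri    : ∀ x y → x ∈ A → y ∈ A → (x < y) ⊎ (x ≡ y) ⊎ (y < x)

chainOrder-strictTotal : ∀ {n} {G : Graph n} {A : Subset n} (O : ChainOrder G A) →
                         StrictTotalOn A (ChainOrder._<_ O)
chainOrder-strictTotal O = record { ChainOrder O }

reverse : ∀ {n} {A : Subset n} {R : Fin n → Fin n → Set} → StrictTotalOn A R → StrictTotalOn A (flip R)
reverse {R = R} sto = record
  { <-irrefl = <-irrefl
  ; <-trans  = λ x y z xA yA zA p q → <-trans z y x zA yA xA q p
  ; <-tri    = λ x y xA yA → swap (<-tri x y xA yA)
  }
  where
  open StrictTotalOn sto
  swap : ∀ {x y} → R x y ⊎ x ≡ y ⊎ R y x → R y x ⊎ x ≡ y ⊎ R x y
  swap (inj₁ p)        = inj₂ (inj₂ p)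
  swap (inj₂ (inj₁ e)) = inj₂ (inj₁ e)
  swap (inj₂ (inj₂ p)) = inj₁ p

_≤[_]_ : ∀ {n} → Fin n → (Fin n → Fin n → Set) → Fin n → Set
x ≤[ R ] y = x ≡ y ⊎ R x y

below-max : ∀ {n} {R : Fin n → Fin n → Set} {P : Fin n → Set} {m x} →
            IsMaxOf R P (just m) → P x → x ≤[ R ] m
below-max {m = m} {x} (_ , max) Px with x ≟ m
... | yes x≡m = inj₁ x≡m
... | no  x≢m = inj₂ (max x Px x≢m)

IsMaxOf-resp : ∀ {n} {R : Fin n → Fin n → Set} {P Q : Fin n → Set} {m} →
               (∀ x → P x ⇔ Q x) → IsMaxOf R P (just m) → IsMaxOf R Q (just m)
IsMaxOf-resp P⇔Q (Pm , max) =
  Equivalence.to (P⇔Q _) Pm , λ x Qx → max x (Equivalence.from (P⇔Q x) Qx)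

module Maxima {n} {A : Subset n} {R : Fin n → Fin n → Set} (sto : StrictTotalOn A R)
  {P : Fin n → Set} (P⊆A : ∀ x → P x → x ∈ A) where

  open StrictTotalOn sto

  max-unique : ∀ {a b} → IsMaxOf R P (just a) → IsMaxOf R P (just b) → a ≡ b
  max-unique {a} {b} (Pa , a-max) (Pb , b-max) with a ≟ b
  ... | yes a≡b = a≡b
  ... | no  a≢b = ⊥-elim (<-irrefl a aA
                    (<-trans a b a aA (P⊆A b Pb) aA (b-max a Pa a≢b) (a-max b Pb (a≢b ∘ sym))))
    where aA = P⊆A a Pa

  module _ (P? : ∀ x → Dec (P x)) where

    private
      MaxIn : List (Fin n) → Fin n → Set
      MaxIn L m = P m × (∀ x → x ∈ₗ L → P x → x ≢ m → R x m)

      adjoin : ∀ {y L m} → P y → MaxIn L m → ∃ (MaxIn (y ∷ L))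
      adjoin {y} {L} {m} Py (Pm , m-max) with <-tri y m (P⊆A y Py) (P⊆A m Pm)
      ... | inj₁ y<m        = m , Pm , λ { x (here refl) _ _ → y<m ; x (there x∈L) → m-max x x∈L }
      ... | inj₂ (inj₁ refl) = m , Pm , λ { x (here refl) _ y≢y → ⊥-elim (y≢y refl)
                                          ; x (there x∈L) → m-max x x∈L }
      ... | inj₂ (inj₂ m<y) = y , Py , λ { x (here refl) _ y≢y → ⊥-elim (y≢y refl)
                                         ; x (there x∈L) Px _ → below-y x x∈L Px }
        where
        below-y : ∀ x → x ∈ₗ L → P x → R x y
        below-y x x∈L Px with x ≟ m
        ... | yes refl = m<y
        ... | no  x≢m  = <-trans x m y (P⊆A x Px) (P⊆A m Pm) (P⊆A y Py) (m-max x x∈L Px x≢m) m<y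

      max-in : ∀ L → (∀ x → x ∈ₗ L → ¬ P x) ⊎ ∃ (MaxIn L)
      max-in [] = inj₁ λ _ ()
      max-in (y ∷ L) with max-in L | P? y
      ... | inj₁ none | no ¬Py = inj₁ λ { x (here refl) → ¬Py ; x (there x∈L) → none x x∈L }
      ... | inj₁ none | yes Py = inj₂ (y , Py , λ { x (here refl) _ y≢y → ⊥-elim (y≢y refl)
                                                 ; x (there x∈L) Px → ⊥-elim (none x x∈L Px) })
      ... | inj₂ (m , Pm , m-max) | no ¬Py =
        inj₂ (m , Pm , λ { x (here refl) Px → ⊥-elim (¬Py Px) ; x (there x∈L) → m-max x x∈L })
      ... | inj₂ (m , max) | yes Py = inj₂ (adjoin Py max)

    max-exists : ∀ {x} → P x → ∃ λ m → IsMaxOf R P (just m)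
    max-exists {x} Px with max-in (allFin n)
    ... | inj₁ none           = ⊥-elim (none x (∈-allFin x) Px)
    ... | inj₂ (m , Pm , max) = m , Pm , λ y → max y (∈-allFin y)

Edge-sym : ∀ {n} (H : Graph n) {u v} → Edge H u v → Edge H v u
Edge-sym H {u} {v} e = trans (adj-sym H v u) e

Edge? : ∀ {n} (H : Graph n) u v → Dec (Edge H u v)
Edge? H u v = adj H u v Bool.≟ true

≡⊎Edge-sym : ∀ {n} (H : Graph n) {u v} → u ≡ v ⊎ Edge H u v → v ≡ u ⊎ Edge H v u
≡⊎Edge-sym H = map sym (Edge-sym H)

ClosedNbhd : ∀ {n} → Graph n → Fin n → Fin n → Set
ClosedNbhd H M x = x ≡ M ⊎ Edge H M x

ClosedNbhd? : ∀ {n} (H : Graph n) M x → Dec (ClosedNbhd H M x)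
ClosedNbhd? H M x = (x ≟ M) ⊎-dec Edge? H M x

module _ {n} {H : Graph n} {S : Subset n} where

  Conn-source : ∀ {u v} → Conn H S u v → u ∈ S
  Conn-source (here u∈S)    = u∈S
  Conn-source (step c _ _) = Conn-source c

  Conn-target : ∀ {u v} → Conn H S u v → v ∈ S
  Conn-target (here v∈S)     = v∈S
  Conn-target (step _ _ v∈S) = v∈S

  Conn-trans : ∀ {u v w} → Conn H S u v → Conn H S v w → Conn H S u w
  Conn-trans c (here _)     = c
  Conn-trans c (step d e w) = step (Conn-trans c d) e w

  Conn-sym : ∀ {u v} → Conn H S u v → Conn H S v u
  Conn-sym (here u∈S)     = here u∈S
  Conn-sym (step c e w∈S) = Conn-trans (step (here w∈S) (Edge-sym H e) (Conn-target c)) (Conn-sym c)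

NoInducedP₃ : ∀ {n} → Graph n → Subset n → Set
NoInducedP₃ H X = ∀ {a b c} → a ∈ X → b ∈ X → c ∈ X → Edge H a b → Edge H b c → a ≡ c ⊎ Edge H a c

module _ {n} {H : Graph n} {X : Subset n} where

  ClusterSet⇒NoInducedP₃ : ClusterSet H X → NoInducedP₃ H X
  ClusterSet⇒NoInducedP₃ cl a∈X b∈X c∈X ab bc = cl _ _ (step (step (here a∈X) ab b∈X) bc c∈X)

  NoInducedP₃⇒ClusterSet : NoInducedP₃ H X → ClusterSet H X
  NoInducedP₃⇒ClusterSet noP₃ _ _ (here _) = inj₁ refl
  NoInducedP₃⇒ClusterSet noP₃ u v (step c e w∈X) with NoInducedP₃⇒ClusterSet noP₃ _ _ c
  ... | inj₁ refl = inj₂ e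
  ... | inj₂ e′   = noP₃ (Conn-source c) (Conn-target c) w∈X e′ e

  module _ (cl : ClusterSet H X) {M} (M∈X : M ∈ X) where

    ClosedNbhd-clique : ∀ {x y} → x ∈ X → y ∈ X → ClosedNbhd H M x → ClosedNbhd H M y →
                        x ≡ y ⊎ Edge H x y
    ClosedNbhd-clique _   _   (inj₁ refl) y~M         = map₁ sym y~M
    ClosedNbhd-clique _   _   (inj₂ Mx)   (inj₁ refl) = inj₂ (Edge-sym H Mx)
    ClosedNbhd-clique x∈X y∈X (inj₂ Mx)   (inj₂ My)   =
      ClusterSet⇒NoInducedP₃ cl x∈X M∈X y∈X (Edge-sym H Mx) My

    ClosedNbhd-closed : ∀ {x y} → x ∈ X → y ∈ X → ClosedNbhd H M x → Edge H x y → ClosedNbhd H M y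
    ClosedNbhd-closed _   _   (inj₁ refl) xy = inj₂ xy
    ClosedNbhd-closed x∈X y∈X (inj₂ Mx)   xy =
      map₁ sym (ClusterSet⇒NoInducedP₃ cl M∈X x∈X y∈X Mx xy)

module Components {n} (H : Graph n) {A : Subset n} {R : Fin n → Fin n → Set} (sto : StrictTotalOn A R)
  {X : Subset n} (X⊆A : X ⊆ A) where

  max-Comp₁ : ∀ {M} → IsMaxOf R (_∈ X) (just M) → IsMaxOf R (Comp₁ H R X) (just M)
  max-Comp₁ M-max@(M∈X , M-above) =
    (_ , M-max , here M∈X) , λ { x (_ , _ , c) → M-above x (Conn-target c) }

  max-Comp₁⇒max : ∀ {M} → IsMaxOf R (Comp₁ H R X) (just M) → IsMaxOf R (_∈ X) (just M)
  max-Comp₁⇒max M-max@((k , k-max , _) , _) =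
    subst (λ m → IsMaxOf R (_∈ X) (just m))
      (Maxima.max-unique sto (λ x (_ , _ , c) → X⊆A (Conn-target c)) (max-Comp₁ k-max) M-max) k-max

  Comp₂⊆X : ∀ {x} → Comp₂ H R X x → x ∈ X
  Comp₂⊆X (_ , _ , m⇝x) = Conn-target m⇝x

  Comp₂⇒¬Comp₁ : ∀ {x} → Comp₂ H R X x → ¬ Comp₁ H R X x
  Comp₂⇒¬Comp₁ (m , ((_ , m∉C₁) , _) , m⇝x) (k , k-max , k⇝x) =
    m∉C₁ (k , k-max , Conn-trans k⇝x (Conn-sym m⇝x))

  module _ (cl : ClusterSet H X) {M} (M-max : IsMaxOf R (_∈ X) (just M)) where

    Comp₁⇔ClosedNbhd : ∀ x → Comp₁ H R X x ⇔ (x ∈ X × ClosedNbhd H M x)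
    Comp₁⇔ClosedNbhd x = mk⇔ to from
      where
      to : Comp₁ H R X x → x ∈ X × ClosedNbhd H M x
      to (m , m-max , m⇝x)
        with Maxima.max-unique sto (λ _ → X⊆A) m-max M-max
      ... | refl = Conn-target m⇝x , map₁ sym (cl m x m⇝x)
      from : x ∈ X × ClosedNbhd H M x → Comp₁ H R X x
      from (x∈X , inj₁ refl) = M , M-max , here x∈X
      from (x∈X , inj₂ Mx)   = M , M-max , step (here (proj₁ M-max)) Mx x∈X

    Comp₂⇒¬ClosedNbhd : ∀ {x} → Comp₂ H R X x → ¬ ClosedNbhd H M x
    Comp₂⇒¬ClosedNbhd {x} c₂ x~M =
      Comp₂⇒¬Comp₁ c₂ (Equivalence.from (Comp₁⇔ClosedNbhd x) (Comp₂⊆X c₂ , x~M))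

    max-Comp₂ : ∀ {M₂} → IsMaxOf R (λ y → y ∈ X × ¬ ClosedNbhd H M y) (just M₂) →
                IsMaxOf R (Comp₂ H R X) (just M₂)
    max-Comp₂ M₂-max@((M₂∈X , _) , M₂-above) =
      (_ , M₂-max′ , here M₂∈X) ,
      λ y c₂ → M₂-above y (Comp₂⊆X c₂ , Comp₂⇒¬ClosedNbhd c₂)
      where
      M₂-max′ : IsMaxOf R (λ y → y ∈ X × ¬ Comp₁ H R X y) (just _)
      M₂-max′ = IsMaxOf-resp {R = R}
        (λ y → mk⇔ (λ (y∈X , ¬y~M) → y∈X , λ c₁ → ¬y~M (proj₂ (Equivalence.to (Comp₁⇔ClosedNbhd y) c₁)))
                   (λ (y∈X , ¬c₁) → y∈X , λ y~M → ¬c₁ (Equivalence.from (Comp₁⇔ClosedNbhd y) (y∈X , y~M))))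
        M₂-max

chain-≤ : ∀ {n} {G : Graph n} {A : Subset n} (O : ChainOrder G A) {t x y} → t ∉ A → x ∈ A → y ∈ A →
          x ≤[ ChainOrder._<_ O ] y → Edge G t x → Edge G t y
chain-≤ O t∉A x∈A y∈A (inj₁ refl) tx = tx
chain-≤ {G = G} O {t} {x} {y} t∉A x∈A y∈A (inj₂ x<y) tx =
  Edge-sym G (ChainOrder.chain O x y x∈A y∈A x<y t t∉A (Edge-sym G tx))

complement-edge⇒¬edge : ∀ {n} (G : Graph n) {u v} → Edge (complement G) u v → ¬ Edge G u v
complement-edge⇒¬edge G {u} {v} e uv with adj G u v
complement-edge⇒¬edge G () _ | true

¬edge⇒complement-edge : ∀ {n} (G : Graph n) {u v} → u ≢ v → ¬ Edge G u v → Edge (complement G) u v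
¬edge⇒complement-edge G {u} {v} u≢v ¬uv with adj G u v | u ≟ v
... | true  | _        = ⊥-elim (¬uv refl)
... | false | yes u≡v = ⊥-elim (u≢v u≡v)
... | false | no  _    = refl

ChainOrder-complement : ∀ {n} {G : Graph n} {A : Subset n} → ChainOrder G A → ChainOrder (complement G) A
ChainOrder-complement {G = G} {A} O = record
  { _<_   = flip _<_
  ; StrictTotalOn (reverse (chainOrder-strictTotal O))
  ; chain = λ v w v∈A w∈A w<v u u∉A vu →
      ¬edge⇒complement-edge G (λ { refl → u∉A w∈A })
        (λ wu → complement-edge⇒¬edge G vu (chain w v w∈A v∈A w<v u u∉A wu))
  }
  where open ChainOrder O

module Transfer {n} {H : Graph n} {A : Subset n} (O : ChainOrder H A)
  {S S' T : Subset n} (S⊆A : S ⊆ A) (S'⊆A : S' ⊆ A) (T⊆∁A : T ⊆ ∁ A)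
  (clS : ClusterSet H S) (clS' : ClusterSet H S')
  (S≡S' : EquivH H (ChainOrder._<_ O) S S') (noP₃ : NoInducedP₃ H (S ∪ T)) where

  open ChainOrder O using (_<_)

  private
    sto = chainOrder-strictTotal O
    module CS  = Components H sto S⊆A
    module CS' = Components H sto S'⊆A

    S⊆S∪T : ∀ {x} → x ∈ S → x ∈ S ∪ T
    S⊆S∪T x∈S = x∈p∪q⁺ (inj₁ x∈S)

    T⊆S∪T : ∀ {x} → x ∈ T → x ∈ S ∪ T
    T⊆S∪T x∈T = x∈p∪q⁺ (inj₂ x∈T)

    T∉A : ∀ {t} → t ∈ T → t ∉ A
    T∉A t∈T = x∈∁p⇒x∉p (T⊆∁A t∈T)

    A≢T : ∀ {x t} → x ∈ A → t ∈ T → x ≢ t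
    A≢T x∈A t∈T refl = T∉A t∈T x∈A

  module Anchored {s} (s∈S' : s ∈ S') where

    private
      M₁-max′ : ∃ λ M → IsMaxOf _<_ (_∈ S') (just M)
      M₁-max′ = Maxima.max-exists sto (λ _ → S'⊆A) (_∈? S') s∈S'

    M₁ : Fin n
    M₁ = proj₁ M₁-max′

    M₁-max-S' : IsMaxOf _<_ (_∈ S') (just M₁)
    M₁-max-S' = proj₂ M₁-max′

    M₁-max-S : IsMaxOf _<_ (_∈ S) (just M₁)
    M₁-max-S = CS.max-Comp₁⇒max (Equivalence.from (proj₁ S≡S' (just M₁)) (CS'.max-Comp₁ M₁-max-S'))

    M₁∈S : M₁ ∈ S
    M₁∈S = proj₁ M₁-max-S

    M₁∈S' : M₁ ∈ S'
    M₁∈S' = proj₁ M₁-max-S'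

    C₁ : Fin n → Set
    C₁ x = x ∈ S' × ClosedNbhd H M₁ x

    private
      m₁-min′ : ∃ λ m → IsMaxOf (flip _<_) C₁ (just m)
      m₁-min′ = Maxima.max-exists (reverse sto) (λ _ → S'⊆A ∘ proj₁)
                  (λ x → (x ∈? S') ×-dec ClosedNbhd? H M₁ x) (M₁∈S' , inj₁ refl)

    m₁ : Fin n
    m₁ = proj₁ m₁-min′

    m₁-below-C₁ : ∀ {x} → C₁ x → m₁ ≤[ _<_ ] x
    m₁-below-C₁ c₁ = map₁ sym (below-max {R = flip _<_} (proj₂ m₁-min′) c₁)

    m₁-min-C₁[S] : IsMaxOf (flip _<_) (Comp₁ H _<_ S) (just m₁)
    m₁-min-C₁[S] = Equivalence.from (proj₁ (proj₂ S≡S') (just m₁))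
      (IsMaxOf-resp {R = flip _<_} (λ x → ⇔-sym (CS'.Comp₁⇔ClosedNbhd clS' M₁-max-S' x)) (proj₂ m₁-min′))

    m₁∈C₁[S] : m₁ ∈ S × ClosedNbhd H M₁ m₁
    m₁∈C₁[S] = Equivalence.to (CS.Comp₁⇔ClosedNbhd clS M₁-max-S m₁) (proj₁ m₁-min-C₁[S])

    max-C₂[S]-above : ∀ {x} → x ∈ S' → ¬ ClosedNbhd H M₁ x →
                      ∃ λ M₂ → M₂ ∈ S × ¬ ClosedNbhd H M₁ M₂ × x ≤[ _<_ ] M₂
    max-C₂[S]-above x∈S' ¬x~M₁ =
      M₂ , CS.Comp₂⊆X C₂M₂ , CS.Comp₂⇒¬ClosedNbhd clS M₁-max-S C₂M₂ ,
      below-max {R = _<_} M₂-max (x∈S' , ¬x~M₁)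
      where
      M₂-max′ = Maxima.max-exists sto (λ _ → S'⊆A ∘ proj₁)
                  (λ y → (y ∈? S') ×-dec ¬? (ClosedNbhd? H M₁ y)) (x∈S' , ¬x~M₁)
      M₂ = proj₁ M₂-max′
      M₂-max = proj₂ M₂-max′
      C₂M₂ : Comp₂ H _<_ S M₂
      C₂M₂ = proj₁ (Equivalence.from (proj₂ (proj₂ S≡S') (just M₂)) (CS'.max-Comp₂ clS' M₁-max-S' M₂-max))

    T-edge⇒edge-M₁ : ∀ {t x} → t ∈ T → x ∈ S' → Edge H t x → Edge H t M₁
    T-edge⇒edge-M₁ t∈T x∈S' tx =
      chain-≤ O (T∉A t∈T) (S'⊆A x∈S') (S'⊆A (M₁∈S')) (below-max {R = _<_} M₁-max-S' x∈S') tx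

    T-edge⇒ClosedNbhd : ∀ {t x} → t ∈ T → x ∈ S' → Edge H t x → ClosedNbhd H M₁ x
    T-edge⇒ClosedNbhd {t} {x} t∈T x∈S' tx with ClosedNbhd? H M₁ x
    ... | yes x~M₁ = x~M₁
    ... | no ¬x~M₁ with max-C₂[S]-above x∈S' ¬x~M₁
    ...   | M₂ , M₂∈S , ¬M₂~M₁ , x≤M₂ =
      ⊥-elim (¬M₂~M₁ (map₁ sym (noP₃ (S⊆S∪T M₁∈S) (T⊆S∪T t∈T) (S⊆S∪T M₂∈S)
                (Edge-sym H (T-edge⇒edge-M₁ t∈T x∈S' tx))
                (chain-≤ O (T∉A t∈T) (S'⊆A x∈S') (S⊆A M₂∈S) x≤M₂ tx))))

    edge-M₁⇒T-edge : ∀ {t x} → t ∈ T → C₁ x → Edge H t M₁ → Edge H t x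
    edge-M₁⇒T-edge {t} t∈T c₁@(x∈S' , _) tM₁ =
      chain-≤ O (T∉A t∈T) (S⊆A m₁∈S) (S'⊆A x∈S') (m₁-below-C₁ c₁) tm₁
      where
      m₁∈S = proj₁ m₁∈C₁[S]
      tm₁ : Edge H t m₁
      tm₁ with proj₂ m₁∈C₁[S]
      ... | inj₁ m₁≡M₁ = subst (Edge H t) (sym m₁≡M₁) tM₁
      ... | inj₂ M₁m₁ with noP₃ (T⊆S∪T t∈T) (S⊆S∪T M₁∈S) (S⊆S∪T m₁∈S) tM₁ M₁m₁
      ...   | inj₁ t≡m₁ = ⊥-elim (A≢T (S⊆A m₁∈S) t∈T (sym t≡m₁))
      ...   | inj₂ tm₁  = tm₁

    S'TS' : ∀ {a b c} → a ∈ S' → b ∈ T → c ∈ S' → Edge H a b → Edge H b c → a ≡ c ⊎ Edge H a c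
    S'TS' a∈S' b∈T c∈S' ab bc = ClosedNbhd-clique clS' (M₁∈S') a∈S' c∈S'
      (T-edge⇒ClosedNbhd b∈T a∈S' (Edge-sym H ab)) (T-edge⇒ClosedNbhd b∈T c∈S' bc)

    S'TT : ∀ {a b c} → a ∈ S' → b ∈ T → c ∈ T → Edge H a b → Edge H b c → a ≡ c ⊎ Edge H a c
    S'TT {c = c} a∈S' b∈T c∈T ab bc =
      inj₂ (Edge-sym H (edge-M₁⇒T-edge c∈T (a∈S' , T-edge⇒ClosedNbhd b∈T a∈S' (Edge-sym H ab)) cM₁))
      where
      cM₁ : Edge H c M₁
      cM₁ with noP₃ (S⊆S∪T M₁∈S) (T⊆S∪T b∈T) (T⊆S∪T c∈T)
                 (Edge-sym H (T-edge⇒edge-M₁ b∈T a∈S' (Edge-sym H ab))) bc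
      ... | inj₁ M₁≡c = ⊥-elim (A≢T (S⊆A M₁∈S) c∈T M₁≡c)
      ... | inj₂ M₁c  = Edge-sym H M₁c

    TS'T : ∀ {a b c} → a ∈ T → b ∈ S' → c ∈ T → Edge H a b → Edge H b c → a ≡ c ⊎ Edge H a c
    TS'T a∈T b∈S' c∈T ab bc = noP₃ (T⊆S∪T a∈T) (S⊆S∪T M₁∈S) (T⊆S∪T c∈T)
      (T-edge⇒edge-M₁ a∈T b∈S' ab) (Edge-sym H (T-edge⇒edge-M₁ c∈T b∈S' (Edge-sym H bc)))

    S'S'T : ∀ {a b c} → a ∈ S' → b ∈ S' → c ∈ T → Edge H a b → Edge H b c → a ≡ c ⊎ Edge H a c
    S'S'T a∈S' b∈S' c∈T ab bc =
      inj₂ (Edge-sym H (edge-M₁⇒T-edge c∈T (a∈S' , a~M₁) (T-edge⇒edge-M₁ c∈T b∈S' cb)))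
      where
      cb = Edge-sym H bc
      a~M₁ = ClosedNbhd-closed clS' (M₁∈S') b∈S' a∈S'
               (T-edge⇒ClosedNbhd c∈T b∈S' cb) (Edge-sym H ab)

  noInducedP₃ : NoInducedP₃ H (S' ∪ T)
  noInducedP₃ a∈ b∈ c∈ ab bc with x∈p∪q⁻ S' T a∈ | x∈p∪q⁻ S' T b∈ | x∈p∪q⁻ S' T c∈
  ... | inj₁ a∈S' | inj₁ b∈S' | inj₁ c∈S' = ClusterSet⇒NoInducedP₃ clS' a∈S' b∈S' c∈S' ab bc
  ... | inj₂ a∈T  | inj₂ b∈T  | inj₂ c∈T  = noP₃ (T⊆S∪T a∈T) (T⊆S∪T b∈T) (T⊆S∪T c∈T) ab bc
  ... | inj₁ a∈S' | inj₂ b∈T  | inj₁ c∈S' = Anchored.S'TS' a∈S' a∈S' b∈T c∈S' ab bc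
  ... | inj₂ a∈T  | inj₁ b∈S' | inj₂ c∈T  = Anchored.TS'T b∈S' a∈T b∈S' c∈T ab bc
  ... | inj₁ a∈S' | inj₂ b∈T  | inj₂ c∈T  = Anchored.S'TT a∈S' a∈S' b∈T c∈T ab bc
  ... | inj₁ a∈S' | inj₁ b∈S' | inj₂ c∈T  = Anchored.S'S'T a∈S' a∈S' b∈S' c∈T ab bc
  ... | inj₂ a∈T  | inj₂ b∈T  | inj₁ c∈S' =
    ≡⊎Edge-sym H (Anchored.S'TT c∈S' c∈S' b∈T a∈T (Edge-sym H bc) (Edge-sym H ab))
  ... | inj₂ a∈T  | inj₁ b∈S' | inj₁ c∈S' =
    ≡⊎Edge-sym H (Anchored.S'S'T c∈S' c∈S' b∈S' a∈T (Edge-sym H bc) (Edge-sym H ab))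

EquivH-sym : ∀ {n} {H : Graph n} {R : Fin n → Fin n → Set} {S S' : Subset n} →
             EquivH H R S S' → EquivH H R S' S
EquivH-sym (max₁ , min₁ , max₂) =
  (λ o → ⇔-sym (max₁ o)) , (λ o → ⇔-sym (min₁ o)) , (λ o → ⇔-sym (max₂ o))

ClusterSet-∪-transfer : ∀ {n} {H : Graph n} {A : Subset n} (O : ChainOrder H A) {S S' T : Subset n} →
  S ⊆ A → S' ⊆ A → T ⊆ ∁ A → ClusterSet H S → ClusterSet H S' → EquivH H (ChainOrder._<_ O) S S' →
  ClusterSet H (S ∪ T) ⇔ ClusterSet H (S' ∪ T)
ClusterSet-∪-transfer O S⊆A S'⊆A T⊆∁A clS clS' S≡S' = mk⇔
  (λ cl → NoInducedP₃⇒ClusterSet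
    (Transfer.noInducedP₃ O S⊆A S'⊆A T⊆∁A clS clS' S≡S' (ClusterSet⇒NoInducedP₃ cl)))
  (λ cl → NoInducedP₃⇒ClusterSet
    (Transfer.noInducedP₃ O S'⊆A S⊆A T⊆∁A clS' clS (EquivH-sym S≡S') (ClusterSet⇒NoInducedP₃ cl)))

proposition5 : (n : ℕ) (G : Graph n) (A : Subset n) → Nonempty A → MimAtMost G A 1 →
    (O : ChainOrder G A) →
    (S₁ S₂ S₁' S₂' : Subset n) → PolarPair G A S₁ S₂ → PolarPair G A S₁' S₂' →
    EquivP O S₁ S₂ S₁' S₂' →
    (T₁ T₂ : Subset n) → T₁ ⊆ ∁ A → T₂ ⊆ ∁ A → Disjoint T₁ T₂ →
    (ClusterSet G (S₁ ∪ T₁) ⇔ ClusterSet G (S₁' ∪ T₁))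
    × (CoClusterSet G (S₂ ∪ T₂) ⇔ CoClusterSet G (S₂' ∪ T₂))
proposition5 n G A _ _ O S₁ S₂ S₁' S₂'
  (S₁⊆A , S₂⊆A , _ , clS₁ , cclS₂) (S₁'⊆A , S₂'⊆A , _ , clS₁' , cclS₂') (S₁≡S₁' , S₂≡S₂')
  T₁ T₂ T₁⊆∁A T₂⊆∁A _ =
    ClusterSet-∪-transfer O S₁⊆A S₁'⊆A T₁⊆∁A clS₁ clS₁' S₁≡S₁'
  , ClusterSet-∪-transfer (ChainOrder-complement O) S₂⊆A S₂'⊆A T₂⊆∁A cclS₂ cclS₂' S₂≡S₂'
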